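{- Let $B\subset\mathbb{Z}^2$ be a box with modulus $\{\alpha,\beta\}$. Then $|\partial B|=\alpha+\beta+4$.
   Context: $X$ is the graph with vertex set $\mathbb{Z}^2$ in which $(x,y)$ and $(x',y')$ are adjacent iff $|x-x'|+|y-y'|=1$. For $A\subset\mathbb{Z}^2$, $\partial A=\{u\in\mathbb{Z}^2\setminus A:\ u \text{ adjacent to some } v\in A\}$. For integers $a,b,c,d$, $B(a,b,c,d)=\{(x,y): a\le y-x\le b,\ c\le y+x\le d\}$; a box is a nonempty set of this form, written with $a,c$ maximal and $b,d$ minimal among all choices giving the same set; its modulus is the unordered pair $\{b-a,d-c\}$. -}

module Defs where

open import Data.Integer using (ℤ; +_; _+_; _-_; _≤_; ∣_∣)
open import Data.Nat using (ℕ)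
import Data.Nat as ℕ
open import Data.Product using (_×_; _,_; Σ; ∃)
open import Data.List using (List; length)
open import Data.List.Membership.Propositional using (_∈_)
open import Data.List.Relation.Unary.Unique.Propositional using (Unique)
open import Relation.Binary.PropositionalEquality using (_≡_)
open import Relation.Nullary using (¬_)
open import Function.Bundles using (_⇔_)

Point : Set
Point = ℤ × ℤ

Subset : Set₁
Subset = Point → Set

Adj : Point → Point → Set
Adj (x , y) (x' , y') = ∣ x - x' ∣ ℕ.+ ∣ y - y' ∣ ≡ 1

∂ : Subset → Subset
∂ A u = ¬ A u × ∃ λ v → A v × Adj u v

Bx : ℤ → ℤ → ℤ → ℤ → Subset
Bx a b c d (x , y) = (a ≤ y - x × y - x ≤ b) × (c ≤ y + x × y + x ≤ d)

_≐_ : Subset → Subset → Set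
A ≐ B = ∀ p → A p ⇔ B p

-- (a,b,c,d) is the normalized representation of a box:
-- the set is nonempty, and a,c are maximal, b,d minimal among all
-- quadruples giving the same set.
IsBoxRep : ℤ → ℤ → ℤ → ℤ → Set
IsBoxRep a b c d =
  (∃ λ p → Bx a b c d p) ×
  (∀ a' b' c' d' → Bx a' b' c' d' ≐ Bx a b c d →
     (a' ≤ a) × (b ≤ b') × (c' ≤ c) × (d ≤ d'))

HasCard : Subset → ℕ → Set
HasCard A n = Σ (List Point) λ l → Unique l × (∀ p → p ∈ l ⇔ A p) × length l ≡ n

-- In the coordinates u = y − x, v = y + x a point of ℤ² is determined by (u, v), the pairs
-- that occur are exactly those with v − u even, and grid neighbours differ by ±1 in both u
-- and v.  So B(a,b,c,d) consists of the lattice pairs in [a,b] × [c,d], and its boundary lies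
-- in the rectangle enlarged by one in every direction.  Conversely a lattice pair of the
-- enlarged rectangle outside B has a neighbour in B unless b = a or d = c; in those degenerate
-- cases the normal form puts points of B on every edge of [a,b] × [c,d], and a frame point
-- without neighbour would lie at distance 1 from such a point along a coordinate line, which
-- parity forbids.  Hence ∂B is the frame of four diagonal segments u = a − 1, u = b + 1 (with
-- d − c + 3 positions) and v = c − 1, v = d + 1 (with b − a + 1 positions), each containing
-- every other position.  Along the left side followed by the top side, and along the bottom
-- side followed by the right side, the parities form two complementary alternating runs of
-- length (b − a) + (d − c) + 4, so the frame has exactly that many points.

module Submission where

open import Defs
open import Data.Integer using (ℤ; +_; _+_; _-_)
open import Data.Product using (_×_; ∃)
open import Relation.Binary.PropositionalEquality using (_≡_)

open import Data.Empty using (⊥-elim)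
open import Data.Integer as ℤ using (-[1+_]; -_; ∣_∣; _≤_; _≟_; _<?_; 1ℤ; -1ℤ; _◃_; pred) renaming (suc to sucℤ)
import Data.Integer.Properties as ℤP
open import Data.Integer.Tactic.RingSolver using (solve-∀)
open import Data.List using ([]; _∷_; _++_)
open import Data.List.Membership.Propositional using (_∈_)
open import Data.List.Membership.Propositional.Properties using (∈-++⁺ˡ; ∈-++⁺ʳ; ∈-++⁻)
open import Data.List.Properties using (length-++)
open import Data.List.Relation.Unary.All using ([])
open import Data.List.Relation.Unary.AllPairs using ([]; _∷_)
open import Data.List.Relation.Unary.Any using (here; there)
import Data.List.Relation.Unary.Unique.Propositional.Properties as Unique
open import Data.Nat as ℕ using (ℕ; zero; suc; parity; ⌊_/2⌋; ⌈_/2⌉)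
import Data.Nat.Properties as ℕP
import Data.Nat.Tactic.RingSolver as ℕSolver
open import Data.Parity.Base as ℙ using (Parity; 0ℙ; 1ℙ; _⁻¹)
import Data.Parity.Properties as ℙP
open import Data.Product using (_,_; ∃₂; proj₁; proj₂; swap; map₁; map₂)
open import Data.Sign.Base using (Sign)
open import Data.Sum using (_⊎_; inj₁; inj₂) renaming (map to map-⊎)
open import Function using (_∘_)
open import Function.Bundles using (_⇔_; mk⇔; module Equivalence)
open import Function.Properties.Equivalence using () renaming (trans to ⇔-trans)
open import Relation.Binary.PropositionalEquality using (_≢_; refl; sym; trans; cong; cong₂; subst; module ≡-Reasoning)
open import Relation.Nullary using (¬_; yes; no)
open import Relation.Unary using (_∪_; _∩_; ∁; Empty)

open Equivalence using (to; from)

parity-suc : ∀ n → parity (suc n) ≡ parity n ⁻¹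
parity-suc = ℙP.+-homo-+ 1

parity≡0ℙ⇒double : ∀ n → parity n ≡ 0ℙ → ∃ λ m → n ≡ m ℕ.+ m
parity≡0ℙ⇒double zero          _    = 0 , refl
parity≡0ℙ⇒double (suc zero)    ()
parity≡0ℙ⇒double (suc (suc n)) even with parity≡0ℙ⇒double n even
... | m , refl = suc m , cong suc (sym (ℕP.+-suc m m))

[p+q]⁻¹≡p+q⁻¹ : ∀ p q → (p ℙ.+ q) ⁻¹ ≡ p ℙ.+ q ⁻¹
[p+q]⁻¹≡p+q⁻¹ 0ℙ q = refl
[p+q]⁻¹≡p+q⁻¹ 1ℙ q = refl

parityℤ : ℤ → Parity
parityℤ i = parity ∣ i ∣

parityℤ-neg : ∀ i → parityℤ (- i) ≡ parityℤ i
parityℤ-neg i = cong parity (ℤP.∣-i∣≡∣i∣ i)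

parityℤ-suc : ∀ i → parityℤ (sucℤ i) ≡ parityℤ i ⁻¹
parityℤ-suc (+ n)        = parity-suc n
parityℤ-suc -[1+ zero ]  = refl
parityℤ-suc -[1+ suc n ] = parity-suc n

parityℤ-+ℕ : ∀ i n → parityℤ (i + + n) ≡ parityℤ i ℙ.+ parity n
parityℤ-+ℕ i zero    = trans (cong parityℤ (ℤP.+-identityʳ i)) (sym (ℙP.+-identityʳ _))
parityℤ-+ℕ i (suc n) = begin
  parityℤ (i + + suc n)         ≡⟨ cong parityℤ (+-suc i (+ n)) ⟩
  parityℤ (sucℤ (i + + n))      ≡⟨ parityℤ-suc (i + + n) ⟩
  parityℤ (i + + n) ⁻¹          ≡⟨ cong _⁻¹ (parityℤ-+ℕ i n) ⟩
  (parityℤ i ℙ.+ parity n) ⁻¹   ≡⟨ [p+q]⁻¹≡p+q⁻¹ (parityℤ i) (parity n) ⟩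
  parityℤ i ℙ.+ parity n ⁻¹     ≡⟨ cong (parityℤ i ℙ.+_) (sym (parity-suc n)) ⟩
  parityℤ i ℙ.+ parity (suc n)  ∎
  where
  open ≡-Reasoning
  -- The ring solver does not unfold sucℤ and pred, so identities about them are stated
  -- with 1ℤ + _ and -1ℤ + _ here and below.
  +-suc : ∀ i j → i + (1ℤ + j) ≡ 1ℤ + (i + j)
  +-suc = solve-∀

parityℤ-+ : ∀ i j → parityℤ (i + j) ≡ parityℤ i ℙ.+ parityℤ j
parityℤ-+ i (+ n)    = parityℤ-+ℕ i n
parityℤ-+ i -[1+ n ] = begin
  parityℤ (i - + suc n)             ≡⟨ cong parityℤ (sub≡-[-+] i (+ suc n)) ⟩
  parityℤ (- (- i + + suc n))       ≡⟨ parityℤ-neg (- i + + suc n) ⟩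
  parityℤ (- i + + suc n)           ≡⟨ parityℤ-+ℕ (- i) (suc n) ⟩
  parityℤ (- i) ℙ.+ parity (suc n)  ≡⟨ cong (ℙ._+ parity (suc n)) (parityℤ-neg i) ⟩
  parityℤ i ℙ.+ parity (suc n)      ∎
  where
  open ≡-Reasoning
  sub≡-[-+] : ∀ i j → i - j ≡ - (- i + j)
  sub≡-[-+] = solve-∀

parityℤ--ℕ : ∀ i n → parityℤ (i - + n) ≡ parityℤ i ℙ.+ parity n
parityℤ--ℕ i n = trans (parityℤ-+ i (- + n)) (cong (parityℤ i ℙ.+_) (parityℤ-neg (+ n)))

parityℤ-swap : ∀ i j → parityℤ (i - j) ≡ parityℤ (j - i)
parityℤ-swap i j = trans (cong parityℤ (i-j≡-[j-i] i j)) (parityℤ-neg (j - i))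
  where i-j≡-[j-i] : ∀ i j → i - j ≡ - (j - i)
        i-j≡-[j-i] = solve-∀

parityℤ-double : ∀ i → parityℤ (i + i) ≡ 0ℙ
parityℤ-double i = trans (parityℤ-+ i i) (ℙP.p+p≡0ℙ (parityℤ i))

parityℤ≡0ℙ⇒double : ∀ i → parityℤ i ≡ 0ℙ → ∃ λ k → i ≡ k + k
parityℤ≡0ℙ⇒double (+ n) even with parity≡0ℙ⇒double n even
... | m , refl = + m , refl
parityℤ≡0ℙ⇒double -[1+ n ] even with parity≡0ℙ⇒double (suc n) even
... | m , 1+n≡m+m = - + m , trans (cong (λ k → - + k) 1+n≡m+m) (ℤP.neg-distrib-+ (+ m) (+ m))

-- Counting parities along runs of consecutive integers

-- evens (parityℤ z) n is the number of even integers among z, z + 1, …, z + n − 1.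
evens : Parity → ℕ → ℕ
evens 0ℙ n = ⌈ n /2⌉
evens 1ℙ n = ⌊ n /2⌋

evens-suc : ∀ p n → evens p (suc n) ≡ evens p 1 ℕ.+ evens (p ⁻¹) n
evens-suc 0ℙ n = refl
evens-suc 1ℙ n = refl

evens-++ : ∀ p m n → evens p (m ℕ.+ n) ≡ evens p m ℕ.+ evens (p ℙ.+ parity m) n
evens-++ 0ℙ zero    n = refl
evens-++ 1ℙ zero    n = refl
evens-++ 0ℙ (suc m) n =
  cong suc (trans (evens-++ 1ℙ m n) (cong (λ q → evens 1ℙ m ℕ.+ evens q n) (sym (parity-suc m))))
evens-++ 1ℙ (suc m) n =
  trans (evens-++ 0ℙ m n) (cong (λ q → evens 0ℙ m ℕ.+ evens q n) (sym (ℙP.suc-homo-⁻¹ m)))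

evens-complement : ∀ p n → evens p n ℕ.+ evens (p ℙ.+ 1ℙ) n ≡ n
evens-complement 0ℙ n = trans (ℕP.+-comm ⌈ n /2⌉ ⌊ n /2⌋) (ℕP.⌊n/2⌋+⌈n/2⌉≡n n)
evens-complement 1ℙ n = ℕP.⌊n/2⌋+⌈n/2⌉≡n n

-- The sides of a frame, in the order left, right, bottom, top: left followed by top and
-- bottom followed by right are complementary runs of length m + n.
evens-around : ∀ p m n →
  evens p m ℕ.+ (evens (p ℙ.+ parity (suc n)) m ℕ.+ (evens (p ℙ.+ 1ℙ) n ℕ.+ evens (p ℙ.+ parity m) n))
    ≡ m ℕ.+ n
evens-around p m n = begin
  L ℕ.+ (R ℕ.+ (B ℕ.+ T))                   ≡⟨ rearrange L R B T ⟩
  (L ℕ.+ T) ℕ.+ (B ℕ.+ R)                   ≡⟨ cong₂ ℕ._+_ (sym (evens-++ p m n)) bottom-then-right ⟩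
  evens p (m ℕ.+ n) ℕ.+ evens p′ (n ℕ.+ m)   ≡⟨ cong (λ k → evens p (m ℕ.+ n) ℕ.+ evens p′ k) (ℕP.+-comm n m) ⟩
  evens p (m ℕ.+ n) ℕ.+ evens p′ (m ℕ.+ n)   ≡⟨ evens-complement p (m ℕ.+ n) ⟩
  m ℕ.+ n                                   ∎
  where
  open ≡-Reasoning
  p′ = p ℙ.+ 1ℙ
  L = evens p m
  R = evens (p ℙ.+ parity (suc n)) m
  B = evens p′ n
  T = evens (p ℙ.+ parity m) n
  rearrange : ∀ l r b t → l ℕ.+ (r ℕ.+ (b ℕ.+ t)) ≡ (l ℕ.+ t) ℕ.+ (b ℕ.+ r)
  rearrange = ℕSolver.solve-∀
  bottom-then-right : B ℕ.+ R ≡ evens p′ (n ℕ.+ m)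
  bottom-then-right = sym (trans (evens-++ p′ n m) (cong (λ q → B ℕ.+ evens q m) (begin
    p′ ℙ.+ parity n       ≡⟨ ℙP.+-assoc p 1ℙ (parity n) ⟩
    p ℙ.+ parity n ⁻¹     ≡⟨ cong (p ℙ.+_) (sym (parity-suc n)) ⟩
    p ℙ.+ parity (suc n)  ∎)))

HasCard-resp : ∀ {A B n} → A ≐ B → HasCard A n → HasCard B n
HasCard-resp A≐B (l , unique , mem , len) = l , unique , (λ p → ⇔-trans (mem p) (A≐B p)) , len

HasCard-∅ : ∀ {A} → Empty A → HasCard A 0
HasCard-∅ empty = [] , [] , (λ p → mk⇔ (λ ()) (⊥-elim ∘ empty p)) , refl

HasCard-singleton : ∀ {A} q → (∀ p → A p ⇔ p ≡ q) → HasCard A 1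
HasCard-singleton q A≐q =
  q ∷ [] , [] ∷ [] , (λ p → mk⇔ (λ { (here p≡q) → from (A≐q p) p≡q ; (there ()) }) (here ∘ to (A≐q p))) , refl

HasCard-∪ : ∀ {A B m n} → HasCard A m → HasCard B n → Empty (A ∩ B) → HasCard (A ∪ B) (m ℕ.+ n)
HasCard-∪ {A} {B} (l₁ , u₁ , mem₁ , len₁) (l₂ , u₂ , mem₂ , len₂) disjoint =
  l₁ ++ l₂ ,
  Unique.++⁺ u₁ u₂ (λ (i₁ , i₂) → disjoint _ (to (mem₁ _) i₁ , to (mem₂ _) i₂)) ,
  (λ p → mk⇔ (split p) (join p)) ,
  trans (length-++ l₁) (cong₂ ℕ._+_ len₁ len₂)
  where
  split : ∀ p → p ∈ l₁ ++ l₂ → (A ∪ B) p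
  split p i with ∈-++⁻ l₁ i
  ... | inj₁ i₁ = inj₁ (to (mem₁ p) i₁)
  ... | inj₂ i₂ = inj₂ (to (mem₂ p) i₂)
  join : ∀ p → (A ∪ B) p → p ∈ l₁ ++ l₂
  join p (inj₁ a) = ∈-++⁺ˡ (from (mem₁ p) a)
  join p (inj₂ b) = ∈-++⁺ʳ l₁ (from (mem₂ p) b)

infix 4 _∈[_,_]
_∈[_,_] : ℤ → ℤ → ℤ → Set
z ∈[ lo , hi ] = lo ≤ z × z ≤ hi

suc≰ : ∀ i → ¬ (sucℤ i ≤ i)
suc≰ i = ℤP.<-irrefl refl ∘ ℤP.suc[i]≤j⇒i<j

≰pred : ∀ i → ¬ (i ≤ pred i)
≰pred i = ℤP.<-irrefl refl ∘ ℤP.i≤pred[j]⇒i<j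

pred≤ : ∀ i → pred i ≤ i
pred≤ i = ℤP.i≤j⇒pred[i]≤j ℤP.≤-refl

≡pred⇒suc≡ : ∀ {z w} → z ≡ pred w → sucℤ z ≡ w
≡pred⇒suc≡ refl = ℤP.suc-pred _

≡suc⇒pred≡ : ∀ {z w} → z ≡ sucℤ w → pred z ≡ w
≡suc⇒pred≡ refl = ℤP.pred-suc _

raise-lo : ∀ {lo z} → lo ≤ z → z ≢ lo → sucℤ lo ≤ z
raise-lo lo≤z z≢lo = ℤP.i<j⇒suc[i]≤j (ℤP.≤∧≢⇒< lo≤z (z≢lo ∘ sym))

lower-hi : ∀ {z hi} → z ≤ hi → z ≢ hi → z ≤ pred hi
lower-hi z≤hi z≢hi = ℤP.i<j⇒i≤pred[j] (ℤP.≤∧≢⇒< z≤hi z≢hi)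

nonneg-gap : ∀ {lo hi} → lo ≤ hi → ∃ λ n → hi ≡ lo + + n
nonneg-gap {lo} {hi} lo≤hi = ∣ hi - lo ∣ ,
  trans (lo+[hi-lo] lo hi) (cong (λ w → lo + w) (sym (ℤP.0≤i⇒+∣i∣≡i (ℤP.i≤j⇒0≤j-i lo≤hi))))
  where lo+[hi-lo] : ∀ lo hi → hi ≡ lo + (hi - lo)
        lo+[hi-lo] = solve-∀

∈[]-single : ∀ {z lo} → z ∈[ lo , lo + + 0 ] ⇔ z ≡ lo
∈[]-single {z} {lo} = mk⇔
  (λ (lo≤z , z≤hi) → ℤP.≤-antisym (subst (z ≤_) (ℤP.+-identityʳ lo) z≤hi) lo≤z)
  (λ { refl → ℤP.≤-refl , ℤP.i≤i+j lo (+ 0) })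

∈[]-split : ∀ {z lo n} → z ∈[ lo , lo + + suc n ] ⇔ (z ≡ lo ⊎ z ∈[ sucℤ lo , sucℤ lo + + n ])
∈[]-split {z} {lo} {n} = mk⇔ split join
  where
  shift : lo + + suc n ≡ sucℤ lo + + n
  shift = +-suc lo (+ n)
    where +-suc : ∀ i j → i + (1ℤ + j) ≡ (1ℤ + i) + j
          +-suc = solve-∀
  split : z ∈[ lo , lo + + suc n ] → z ≡ lo ⊎ z ∈[ sucℤ lo , sucℤ lo + + n ]
  split (lo≤z , z≤hi) with z ≟ lo
  ... | yes z≡lo = inj₁ z≡lo
  ... | no  z≢lo = inj₂ (raise-lo lo≤z z≢lo , subst (z ≤_) shift z≤hi)
  join : z ≡ lo ⊎ z ∈[ sucℤ lo , sucℤ lo + + n ] → z ∈[ lo , lo + + suc n ]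
  join (inj₁ refl)          = ℤP.≤-refl , ℤP.i≤i+j lo (+ suc n)
  join (inj₂ (lo<z , z≤hi)) = ℤP.≤-trans (ℤP.i≤suc[i] lo) lo<z , subst (z ≤_) (sym shift) z≤hi

∈[]-widen : ∀ {z lo hi} → z ∈[ lo , hi ] → z ∈[ pred lo , sucℤ hi ]
∈[]-widen (lo≤z , z≤hi) = ℤP.i≤j⇒pred[i]≤j lo≤z , ℤP.i≤j⇒i≤1+j z≤hi

∈[]-trichotomy : ∀ lo hi {z} → z ∈[ pred lo , sucℤ hi ] → z ≡ pred lo ⊎ z ∈[ lo , hi ] ⊎ z ≡ sucℤ hi
∈[]-trichotomy lo hi {z} (lo≤z , z≤hi) with z ≟ pred lo | z ≟ sucℤ hi
... | yes z≡lo | _        = inj₁ z≡lo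
... | no  _    | yes z≡hi = inj₂ (inj₂ z≡hi)
... | no  z≢lo | no  z≢hi = inj₂ (inj₁
  ( subst (_≤ z) (ℤP.suc-pred lo) (raise-lo lo≤z z≢lo)
  , subst (z ≤_) (ℤP.pred-suc hi) (lower-hi z≤hi z≢hi)))

∈[]-squeeze : ∀ {z w lo hi} → z ∈[ lo , hi ] → hi ≤ w → w ≤ lo → z ≡ w
∈[]-squeeze (lo≤z , z≤hi) hi≤w w≤lo = ℤP.≤-antisym (ℤP.≤-trans z≤hi hi≤w) (ℤP.≤-trans w≤lo lo≤z)

below-lo : ∀ {z lo} → z ≡ pred lo → ¬ (lo ≤ z)
below-lo refl = ≰pred _

above-hi : ∀ {z hi} → z ≡ sucℤ hi → ¬ (z ≤ hi)
above-hi refl = suc≰ _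

pred-lo∈[] : ∀ {z lo hi} → lo ≤ hi → z ≡ pred lo → z ∈[ pred lo , sucℤ hi ]
pred-lo∈[] lo≤hi refl = ℤP.≤-refl , ℤP.≤-trans (pred≤ _) (ℤP.i≤j⇒i≤1+j lo≤hi)

suc-hi∈[] : ∀ {z lo hi} → lo ≤ hi → z ≡ sucℤ hi → z ∈[ pred lo , sucℤ hi ]
suc-hi∈[] lo≤hi refl = ℤP.≤-trans (pred≤ _) (ℤP.i≤j⇒i≤1+j lo≤hi) , ℤP.≤-refl

pred-lo≢suc-hi : ∀ {lo hi} → lo ≤ hi → pred lo ≢ sucℤ hi
pred-lo≢suc-hi lo≤hi = ℤP.<⇒≢ (ℤP.≤-<-trans (ℤP.i≤j⇒pred[i]≤j lo≤hi) (ℤP.suc[i]≤j⇒i<j ℤP.≤-refl))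

-- step + and step - are definitionally sucℤ and pred.
step : Sign → ℤ → ℤ
step s i = (s ◃ 1) + i

step-sub : ∀ s i j → step s i - j ≡ step s (i - j)
step-sub s = assoc (s ◃ 1)
  where assoc : ∀ e i j → (e + i) - j ≡ e + (i - j)
        assoc = solve-∀

parityℤ-step : ∀ s i → parityℤ (step s i) ≡ parityℤ i ⁻¹
parityℤ-step Sign.+ = parityℤ-+ 1ℤ
parityℤ-step Sign.- = parityℤ-+ -1ℤ

∈[]-step-widen : ∀ s {z lo hi} → z ∈[ lo , hi ] → step s z ∈[ pred lo , sucℤ hi ]
∈[]-step-widen Sign.+ (lo≤z , z≤hi) = ℤP.≤-trans (ℤP.i≤j⇒pred[i]≤j lo≤z) (ℤP.i≤suc[i] _) , ℤP.suc-mono z≤hi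
∈[]-step-widen Sign.- (lo≤z , z≤hi) = ℤP.pred-mono lo≤z , ℤP.i≤j⇒pred[i]≤j (ℤP.i≤j⇒i≤1+j z≤hi)

∈[]-step-into : ∀ lo hi {z} → z ∈[ pred lo , sucℤ hi ] →
  (∃ λ s → step s z ∈[ lo , hi ]) ⊎ (hi ≤ z × z ≤ lo)
∈[]-step-into lo hi {z} (lo≤z , z≤hi) with z <? hi | lo <? z
... | yes z<hi | _        =
  inj₁ (Sign.+ , subst (_≤ sucℤ z) (ℤP.suc-pred lo) (ℤP.suc-mono lo≤z) , ℤP.i<j⇒suc[i]≤j z<hi)
... | no  _    | yes lo<z =
  inj₁ (Sign.- , ℤP.i<j⇒i≤pred[j] lo<z , subst (pred z ≤_) (ℤP.pred-suc hi) (ℤP.pred-mono z≤hi))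
... | no  z≮hi | no  lo≮z = inj₂ (ℤP.≮⇒≥ z≮hi , ℤP.≮⇒≥ lo≮z)

-- Rotated coordinates

U V : Point → ℤ
U (x , y) = y - x
V (x , y) = y + x

V-U≡2x : ∀ x y → V (x , y) - U (x , y) ≡ x + x
V-U≡2x = ring
  where ring : ∀ x y → (y + x) - (y - x) ≡ x + x
        ring = solve-∀

V-U-even : ∀ p → parityℤ (V p - U p) ≡ 0ℙ
V-U-even (x , y) = trans (cong parityℤ (V-U≡2x x y)) (parityℤ-double x)

double-injective : ∀ {i j} → i + i ≡ j + j → i ≡ j
double-injective {i} {j} i+i≡j+j = ℤP.*-cancelˡ-≡ (+ 2) i j (trans (2*≡+ i) (trans i+i≡j+j (sym (2*≡+ j))))
  where 2*≡+ : ∀ i → + 2 ℤ.* i ≡ i + i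
        2*≡+ = solve-∀

UV-injective : ∀ {p q} → U p ≡ U q → V p ≡ V q → p ≡ q
UV-injective {x , y} {x′ , y′} U≡ V≡ =
  cong₂ _,_ x≡x′ (trans (y≡U+x x y) (trans (cong₂ _+_ U≡ x≡x′) (sym (y≡U+x x′ y′))))
  where
  x≡x′ : x ≡ x′
  x≡x′ = double-injective (trans (sym (V-U≡2x x y)) (trans (cong₂ _-_ V≡ U≡) (V-U≡2x x′ y′)))
  y≡U+x : ∀ x y → y ≡ (y - x) + x
  y≡U+x = solve-∀

UV-point-card-even : ∀ u v → (∃ λ k → v - u ≡ k + k) → HasCard (λ p → U p ≡ u × V p ≡ v) 1
UV-point-card-even u v (k , v-u≡k+k) = HasCard-singleton (k , u + k) λ p → mk⇔
  (λ (U≡u , V≡v) → UV-injective (trans U≡u (sym U≡)) (trans V≡v (sym V≡)))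
  (λ { refl → U≡ , V≡ })
  where
  U≡ : U (k , u + k) ≡ u
  U≡ = cancel u k
    where cancel : ∀ u k → (u + k) - k ≡ u
          cancel = solve-∀
  V≡ : V (k , u + k) ≡ v
  V≡ = trans (assoc u k) (trans (cong (λ w → u + w) (sym v-u≡k+k)) (u+[v-u] u v))
    where assoc : ∀ u k → (u + k) + k ≡ u + (k + k)
          assoc = solve-∀
          u+[v-u] : ∀ u v → u + (v - u) ≡ v
          u+[v-u] = solve-∀

UV-point-card : ∀ u v → HasCard (λ p → U p ≡ u × V p ≡ v) (evens (parityℤ (v - u)) 1)
UV-point-card u v with parityℤ (v - u) in v-u-parity
... | 0ℙ = UV-point-card-even u v (parityℤ≡0ℙ⇒double (v - u) v-u-parity)
... | 1ℙ = HasCard-∅ λ p (U≡u , V≡v) → ℙP.p≢p⁻¹ 0ℙ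
  (trans (sym (V-U-even p)) (trans (cong₂ (λ v u → parityℤ (v - u)) V≡v U≡u) v-u-parity))

VU-point-card : ∀ v u → HasCard (λ p → V p ≡ v × U p ≡ u) (evens (parityℤ (u - v)) 1)
VU-point-card v u = subst (λ P → HasCard (λ p → V p ≡ v × U p ≡ u) (evens P 1)) (parityℤ-swap v u)
  (HasCard-resp (λ p → mk⇔ swap swap) (UV-point-card u v))

Seg : (Point → ℤ) → (Point → ℤ) → ℤ → ℤ → ℤ → Subset
Seg f g k lo hi p = f p ≡ k × g p ∈[ lo , hi ]

Seg-card : ∀ f g → (∀ k l → HasCard (λ p → f p ≡ k × g p ≡ l) (evens (parityℤ (l - k)) 1)) →
  ∀ k lo hi n → hi ≡ lo + + n → HasCard (Seg f g k lo hi) (evens (parityℤ (lo - k)) (suc n))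
Seg-card f g points k lo _ zero refl =
  HasCard-resp (λ p → mk⇔ (map₂ (from ∈[]-single)) (map₂ (to ∈[]-single))) (points k lo)
Seg-card f g points k lo _ (suc n) refl = subst (HasCard _) count
  (HasCard-resp split (HasCard-∪ (points k lo) (Seg-card f g points k (sucℤ lo) _ n refl) disjoint))
  where
  P = parityℤ (lo - k)
  count : evens P 1 ℕ.+ evens (parityℤ (sucℤ lo - k)) (suc n) ≡ evens P (suc (suc n))
  count = trans (cong (λ q → evens P 1 ℕ.+ evens q (suc n)) (trans (cong parityℤ (suc-sub lo k)) (parityℤ-suc (lo - k))))
                (sym (evens-suc P (suc n)))
    where suc-sub : ∀ i j → (1ℤ + i) - j ≡ 1ℤ + (i - j)
          suc-sub = solve-∀
  split : ((λ p → f p ≡ k × g p ≡ lo) ∪ Seg f g k (sucℤ lo) (sucℤ lo + + n)) ≐ Seg f g k lo (lo + + suc n)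
  split p = mk⇔
    (λ { (inj₁ (fk , g≡lo)) → fk , from ∈[]-split (inj₁ g≡lo) ; (inj₂ (fk , g∈)) → fk , from ∈[]-split (inj₂ g∈) })
    (λ (fk , g∈) → map-⊎ (fk ,_) (fk ,_) (to ∈[]-split g∈))
  disjoint : Empty ((λ p → f p ≡ k × g p ≡ lo) ∩ Seg f g k (sucℤ lo) (sucℤ lo + + n))
  disjoint p ((_ , g≡lo) , (_ , lo<g , _)) = suc≰ lo (subst (sucℤ lo ≤_) g≡lo lo<g)

unit-vector⇒steps : ∀ i j → ∣ i ∣ ℕ.+ ∣ j ∣ ≡ 1 → ∃₂ λ s t → j - i ≡ s ◃ 1 × j + i ≡ t ◃ 1
unit-vector⇒steps (+ 1)           (+ 0)           _ = Sign.- , Sign.+ , refl , refl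
unit-vector⇒steps -[1+ 0 ]        (+ 0)           _ = Sign.+ , Sign.- , refl , refl
unit-vector⇒steps (+ 0)           (+ 1)           _ = Sign.+ , Sign.+ , refl , refl
unit-vector⇒steps (+ 0)           -[1+ 0 ]        _ = Sign.- , Sign.- , refl , refl
unit-vector⇒steps (+ 0)           (+ 0)           ()
unit-vector⇒steps (+ 0)           (+ suc (suc _)) ()
unit-vector⇒steps (+ 0)           -[1+ suc _ ]    ()
unit-vector⇒steps (+ 1)           (+ suc _)       ()
unit-vector⇒steps (+ 1)           -[1+ _ ]        ()
unit-vector⇒steps (+ suc (suc _)) _               ()
unit-vector⇒steps -[1+ 0 ]        (+ suc _)       ()
unit-vector⇒steps -[1+ 0 ]        -[1+ _ ]        ()
unit-vector⇒steps -[1+ suc _ ]    _               ()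

steps⇒unit-vector : ∀ s t → ∃₂ λ i j → ∣ i ∣ ℕ.+ ∣ j ∣ ≡ 1 × j - i ≡ s ◃ 1 × j + i ≡ t ◃ 1
steps⇒unit-vector Sign.- Sign.+ = + 1      , + 0      , refl , refl , refl
steps⇒unit-vector Sign.+ Sign.- = -[1+ 0 ] , + 0      , refl , refl , refl
steps⇒unit-vector Sign.+ Sign.+ = + 0      , + 1      , refl , refl , refl
steps⇒unit-vector Sign.- Sign.- = + 0      , -[1+ 0 ] , refl , refl , refl

Adj⇒steps : ∀ p q → Adj p q → ∃₂ λ s t → U p ≡ step s (U q) × V p ≡ step t (V q)
Adj⇒steps (x , y) (x′ , y′) adj with unit-vector⇒steps (x - x′) (y - y′) adj
... | s , t , Δu , Δv =
  s , t , trans (U-split x y x′ y′) (cong (_+ (y′ - x′)) Δu) , trans (V-split x y x′ y′) (cong (_+ (y′ + x′)) Δv)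
  where
  U-split : ∀ x y x′ y′ → y - x ≡ ((y - y′) - (x - x′)) + (y′ - x′)
  U-split = solve-∀
  V-split : ∀ x y x′ y′ → y + x ≡ ((y - y′) + (x - x′)) + (y′ + x′)
  V-split = solve-∀

neighbour : ∀ p s t → ∃ λ q → Adj p q × U q ≡ step s (U p) × V q ≡ step t (V p)
neighbour (x , y) s t with steps⇒unit-vector s t
... | i , j , unit , Δu , Δv =
  (x + i , y + j) ,
  trans (cong₂ (λ m n → ∣ m ∣ ℕ.+ ∣ n ∣) (back x i) (back y j)) (trans (cong₂ ℕ._+_ (ℤP.∣-i∣≡∣i∣ i) (ℤP.∣-i∣≡∣i∣ j)) unit) ,
  trans (U-shift x y i j) (cong (_+ (y - x)) Δu) ,
  trans (V-shift x y i j) (cong (_+ (y + x)) Δv)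
  where
  back : ∀ z k → z - (z + k) ≡ - k
  back = solve-∀
  U-shift : ∀ x y i j → (y + j) - (x + i) ≡ (j - i) + (y - x)
  U-shift = solve-∀
  V-shift : ∀ x y i j → (y + j) + (x + i) ≡ (j + i) + (y + x)
  V-shift = solve-∀

U≡⇒V≢step : ∀ p q t → U q ≡ U p → V q ≢ step t (V p)
U≡⇒V≢step p q t Uq≡Up Vq≡ = ℙP.p≢p⁻¹ 0ℙ (begin
  0ℙ                            ≡⟨ sym (V-U-even q) ⟩
  parityℤ (V q - U q)           ≡⟨ cong₂ (λ v u → parityℤ (v - u)) Vq≡ Uq≡Up ⟩
  parityℤ (step t (V p) - U p)  ≡⟨ cong parityℤ (step-sub t (V p) (U p)) ⟩
  parityℤ (step t (V p - U p))  ≡⟨ parityℤ-step t (V p - U p) ⟩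
  parityℤ (V p - U p) ⁻¹        ≡⟨ cong _⁻¹ (V-U-even p) ⟩
  1ℙ                            ∎)
  where open ≡-Reasoning

V≡⇒U≢step : ∀ p q s → V q ≡ V p → U q ≢ step s (U p)
V≡⇒U≢step p q s Vq≡Vp Uq≡ = ℙP.p≢p⁻¹ 0ℙ (begin
  0ℙ                            ≡⟨ sym (V-U-even q) ⟩
  parityℤ (V q - U q)           ≡⟨ parityℤ-swap (V q) (U q) ⟩
  parityℤ (U q - V q)           ≡⟨ cong₂ (λ u v → parityℤ (u - v)) Uq≡ Vq≡Vp ⟩
  parityℤ (step s (U p) - V p)  ≡⟨ cong parityℤ (step-sub s (U p) (V p)) ⟩
  parityℤ (step s (U p - V p))  ≡⟨ parityℤ-step s (U p - V p) ⟩
  parityℤ (U p - V p) ⁻¹        ≡⟨ cong _⁻¹ (trans (parityℤ-swap (U p) (V p)) (V-U-even p)) ⟩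
  1ℙ                            ∎)
  where open ≡-Reasoning

-- The boundary of a box

Bx⁺ : ℤ → ℤ → ℤ → ℤ → Subset
Bx⁺ a b c d = Bx (pred a) (sucℤ b) (pred c) (sucℤ d)

Adj-Bx⇒Bx⁺ : ∀ {a b c d} p q → Bx a b c d q → Adj p q → Bx⁺ a b c d p
Adj-Bx⇒Bx⁺ {a} {b} {c} {d} p q (u∈ , v∈) adj with Adj⇒steps p q adj
... | s , t , Up≡ , Vp≡ =
  subst (_∈[ pred a , sucℤ b ]) (sym Up≡) (∈[]-step-widen s u∈) ,
  subst (_∈[ pred c , sucℤ d ]) (sym Vp≡) (∈[]-step-widen t v∈)

-- Stated negatively: this is what maximality in IsBoxRep yields constructively, and all the
-- boundary argument needs.
Meets : Subset → (Point → ℤ) → ℤ → Set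
Meets A f k = ¬ (∀ q → A q → f q ≢ k)

record Tight (a b c d : ℤ) : Set where
  field
    meets-a : Meets (Bx a b c d) U a
    meets-b : Meets (Bx a b c d) U b
    meets-c : Meets (Bx a b c d) V c
    meets-d : Meets (Bx a b c d) V d

-- If the box missed the line U = a, then Bx (sucℤ a) b c d would be the same set, against the
-- maximality of a; similarly for the other three edges.
IsBoxRep⇒Tight : ∀ {a b c d} → IsBoxRep a b c d → Tight a b c d
IsBoxRep⇒Tight {a} {b} {c} {d} (_ , extremal) = record
  { meets-a = λ misses → suc≰ a (proj₁ (extremal (sucℤ a) b c d λ p → mk⇔
      (map₁ (map₁ (ℤP.≤-trans (ℤP.i≤suc[i] a))))
      (λ box → (raise-lo (proj₁ (proj₁ box)) (misses p box) , proj₂ (proj₁ box)) , proj₂ box)))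
  ; meets-b = λ misses → ≰pred b (proj₁ (proj₂ (extremal a (pred b) c d λ p → mk⇔
      (map₁ (map₂ (λ u≤ → ℤP.≤-trans u≤ (pred≤ b))))
      (λ box → (proj₁ (proj₁ box) , lower-hi (proj₂ (proj₁ box)) (misses p box)) , proj₂ box))))
  ; meets-c = λ misses → suc≰ c (proj₁ (proj₂ (proj₂ (extremal a b (sucℤ c) d λ p → mk⇔
      (map₂ (map₁ (ℤP.≤-trans (ℤP.i≤suc[i] c))))
      (λ box → proj₁ box , raise-lo (proj₁ (proj₂ box)) (misses p box) , proj₂ (proj₂ box))))))
  ; meets-d = λ misses → ≰pred d (proj₂ (proj₂ (proj₂ (extremal a b c (pred d) λ p → mk⇔
      (map₂ (map₂ (λ v≤ → ℤP.≤-trans v≤ (pred≤ d))))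
      (λ box → proj₁ box , proj₁ (proj₂ box) , lower-hi (proj₂ (proj₂ box)) (misses p box))))))
  }

Frame : ℤ → ℤ → ℤ → ℤ → Subset
Frame a b c d = Seg U V (pred a) (pred c) (sucℤ d) ∪ Seg U V (sucℤ b) (pred c) (sucℤ d)
              ∪ Seg V U (pred c) a b ∪ Seg V U (sucℤ d) a b

module _ {a b c d : ℤ} (a≤b : a ≤ b) (c≤d : c ≤ d) where

  Frame≐Bx⁺∖Bx : Frame a b c d ≐ (Bx⁺ a b c d ∩ ∁ (Bx a b c d))
  Frame≐Bx⁺∖Bx p = mk⇔ into outof
    where
    into : Frame a b c d p → (Bx⁺ a b c d ∩ ∁ (Bx a b c d)) p
    into (inj₁ (u≡ , v∈))               = (pred-lo∈[] a≤b u≡ , v∈) , λ ((a≤u , _) , _) → below-lo u≡ a≤u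
    into (inj₂ (inj₁ (u≡ , v∈)))        = (suc-hi∈[] a≤b u≡ , v∈) , λ ((_ , u≤b) , _) → above-hi u≡ u≤b
    into (inj₂ (inj₂ (inj₁ (v≡ , u∈)))) = (∈[]-widen u∈ , pred-lo∈[] c≤d v≡) , λ (_ , (c≤v , _)) → below-lo v≡ c≤v
    into (inj₂ (inj₂ (inj₂ (v≡ , u∈)))) = (∈[]-widen u∈ , suc-hi∈[] c≤d v≡) , λ (_ , (_ , v≤d)) → above-hi v≡ v≤d
    outof : (Bx⁺ a b c d ∩ ∁ (Bx a b c d)) p → Frame a b c d p
    outof ((u∈ , v∈) , p∉B) with ∈[]-trichotomy a b u∈
    ... | inj₁ u≡        = inj₁ (u≡ , v∈)
    ... | inj₂ (inj₂ u≡) = inj₂ (inj₁ (u≡ , v∈))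
    ... | inj₂ (inj₁ u∈′) with ∈[]-trichotomy c d v∈
    ...   | inj₁ v≡         = inj₂ (inj₂ (inj₁ (v≡ , u∈′)))
    ...   | inj₂ (inj₂ v≡)  = inj₂ (inj₂ (inj₂ (v≡ , u∈′)))
    ...   | inj₂ (inj₁ v∈′) = ⊥-elim (p∉B (u∈′ , v∈′))

  module _ (tight : Tight a b c d) where
    open Tight tight

    -- When b ≤ U p ≤ a the box lies on the single line U = U p, where a point of Bx⁺ outside
    -- the box would be at V-distance 1 from the box points that Tight puts on V = c or V = d.
    thin-column : ∀ p → b ≤ U p → U p ≤ a → V p ∈[ pred c , sucℤ d ] → Bx a b c d p
    thin-column p b≤u u≤a v∈ with ∈[]-trichotomy c d v∈
    ... | inj₁ v≡ = ⊥-elim (meets-c λ q (u∈ , _) Vq≡c →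
      U≡⇒V≢step p q Sign.+ (∈[]-squeeze u∈ b≤u u≤a) (trans Vq≡c (sym (≡pred⇒suc≡ v≡))))
    ... | inj₂ (inj₁ v∈′) = (ℤP.≤-trans a≤b b≤u , ℤP.≤-trans u≤a a≤b) , v∈′
    ... | inj₂ (inj₂ v≡) = ⊥-elim (meets-d λ q (u∈ , _) Vq≡d →
      U≡⇒V≢step p q Sign.- (∈[]-squeeze u∈ b≤u u≤a) (trans Vq≡d (sym (≡suc⇒pred≡ v≡))))

    thin-row : ∀ p → d ≤ V p → V p ≤ c → U p ∈[ pred a , sucℤ b ] → Bx a b c d p
    thin-row p d≤v v≤c u∈ with ∈[]-trichotomy a b u∈
    ... | inj₁ u≡ = ⊥-elim (meets-a λ q (_ , v∈) Uq≡a →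
      V≡⇒U≢step p q Sign.+ (∈[]-squeeze v∈ d≤v v≤c) (trans Uq≡a (sym (≡pred⇒suc≡ u≡))))
    ... | inj₂ (inj₁ u∈′) = u∈′ , (ℤP.≤-trans c≤d d≤v , ℤP.≤-trans v≤c c≤d)
    ... | inj₂ (inj₂ u≡) = ⊥-elim (meets-b λ q (_ , v∈) Uq≡b →
      V≡⇒U≢step p q Sign.- (∈[]-squeeze v∈ d≤v v≤c) (trans Uq≡b (sym (≡suc⇒pred≡ u≡))))

    Bx⁺∖Bx⊆∂ : ∀ p → (Bx⁺ a b c d ∩ ∁ (Bx a b c d)) p → ∂ (Bx a b c d) p
    Bx⁺∖Bx⊆∂ p ((u∈ , v∈) , p∉B) with ∈[]-step-into a b u∈ | ∈[]-step-into c d v∈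
    ... | inj₂ (b≤u , u≤a) | _                = ⊥-elim (p∉B (thin-column p b≤u u≤a v∈))
    ... | inj₁ _           | inj₂ (d≤v , v≤c) = ⊥-elim (p∉B (thin-row p d≤v v≤c u∈))
    ... | inj₁ (s , su∈)   | inj₁ (t , tv∈) with neighbour p s t
    ...   | q , adj , Uq≡ , Vq≡ =
      p∉B , q , (subst (_∈[ a , b ]) (sym Uq≡) su∈ , subst (_∈[ c , d ]) (sym Vq≡) tv∈) , adj

    Bx⁺∖Bx≐∂ : (Bx⁺ a b c d ∩ ∁ (Bx a b c d)) ≐ ∂ (Bx a b c d)
    Bx⁺∖Bx≐∂ p = mk⇔ (Bx⁺∖Bx⊆∂ p) (λ (p∉B , q , q∈B , adj) → Adj-Bx⇒Bx⁺ p q q∈B adj , p∉B)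

frame-sides-count : ∀ a c W H →
  let b = a + + W ; d = c + + H in
  evens (parityℤ (pred c - pred a)) (3 ℕ.+ H) ℕ.+ (evens (parityℤ (pred c - sucℤ b)) (3 ℕ.+ H) ℕ.+
    (evens (parityℤ (a - pred c)) (suc W) ℕ.+ evens (parityℤ (a - sucℤ d)) (suc W)))
  ≡ W ℕ.+ H ℕ.+ 4
frame-sides-count a c W H =
  trans (cong₂ (λ r bt → evens P (3 ℕ.+ H) ℕ.+ (evens r (3 ℕ.+ H) ℕ.+ bt)) right-parity
          (cong₂ (λ p q → evens p (suc W) ℕ.+ evens q (suc W)) bottom-parity top-parity))
        (trans (evens-around P (3 ℕ.+ H) (suc W)) (arith H W))
  where
  P = parityℤ (pred c - pred a)
  right-parity : parityℤ (pred c - sucℤ (a + + W)) ≡ P ℙ.+ parity (suc (suc W))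
  right-parity = trans (cong parityℤ (ring a c (+ W))) (parityℤ--ℕ (pred c - pred a) (suc (suc W)))
    where ring : ∀ a c w → (-1ℤ + c) - (1ℤ + (a + w)) ≡ ((-1ℤ + c) - (-1ℤ + a)) - (+ 2 + w)
          ring = solve-∀
  bottom-parity : parityℤ (a - pred c) ≡ P ℙ.+ 1ℙ
  bottom-parity = trans (cong parityℤ (ring a c)) (trans (parityℤ-+ℕ (- (pred c - pred a)) 1)
                    (cong (ℙ._+ 1ℙ) (parityℤ-neg (pred c - pred a))))
    where ring : ∀ a c → a - (-1ℤ + c) ≡ - ((-1ℤ + c) - (-1ℤ + a)) + + 1
          ring = solve-∀
  top-parity : parityℤ (a - sucℤ (c + + H)) ≡ P ℙ.+ parity (suc H)
  top-parity = trans (cong parityℤ (ring a c (+ H))) (trans (parityℤ--ℕ (- (pred c - pred a)) (suc H))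
                 (cong (ℙ._+ parity (suc H)) (parityℤ-neg (pred c - pred a))))
    where ring : ∀ a c h → a - (1ℤ + (c + h)) ≡ - ((-1ℤ + c) - (-1ℤ + a)) - (+ 1 + h)
          ring = solve-∀
  arith : ∀ H W → 3 ℕ.+ H ℕ.+ suc W ≡ W ℕ.+ H ℕ.+ 4
  arith = ℕSolver.solve-∀

Frame-card : ∀ a c W H → HasCard (Frame a (a + + W) c (c + + H)) (W ℕ.+ H ℕ.+ 4)
Frame-card a c W H = subst (HasCard (Frame a b c d)) (frame-sides-count a c W H)
  (HasCard-∪ left (HasCard-∪ right (HasCard-∪ bottom top bottom∩top) right∩) left∩)
  where
  b = a + + W
  d = c + + H
  top-end : sucℤ d ≡ pred c + + suc (suc H)
  top-end = ring c (+ H)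
    where ring : ∀ c h → 1ℤ + (c + h) ≡ (-1ℤ + c) + (+ 2 + h)
          ring = solve-∀
  left   = Seg-card U V UV-point-card (pred a) (pred c) (sucℤ d) (suc (suc H)) top-end
  right  = Seg-card U V UV-point-card (sucℤ b) (pred c) (sucℤ d) (suc (suc H)) top-end
  bottom = Seg-card V U VU-point-card (pred c) a b W refl
  top    = Seg-card V U VU-point-card (sucℤ d) a b W refl
  left∩ : Empty (Seg U V (pred a) (pred c) (sucℤ d)
                 ∩ (Seg U V (sucℤ b) (pred c) (sucℤ d) ∪ Seg V U (pred c) a b ∪ Seg V U (sucℤ d) a b))
  left∩ p ((u≡ , _) , inj₁ (u≡′ , _))               = pred-lo≢suc-hi (ℤP.i≤i+j a (+ W)) (trans (sym u≡) u≡′)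
  left∩ p ((u≡ , _) , inj₂ (inj₁ (_ , (a≤u , _)))) = below-lo u≡ a≤u
  left∩ p ((u≡ , _) , inj₂ (inj₂ (_ , (a≤u , _)))) = below-lo u≡ a≤u
  right∩ : Empty (Seg U V (sucℤ b) (pred c) (sucℤ d) ∩ (Seg V U (pred c) a b ∪ Seg V U (sucℤ d) a b))
  right∩ p ((u≡ , _) , inj₁ (_ , (_ , u≤b))) = above-hi u≡ u≤b
  right∩ p ((u≡ , _) , inj₂ (_ , (_ , u≤b))) = above-hi u≡ u≤b
  bottom∩top : Empty (Seg V U (pred c) a b ∩ Seg V U (sucℤ d) a b)
  bottom∩top p ((v≡ , _) , (v≡′ , _)) = pred-lo≢suc-hi (ℤP.i≤i+j c (+ H)) (trans (sym v≡) v≡′)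

lemma5p7 : (a b c d : ℤ) → IsBoxRep a b c d →
    ∃ λ n → HasCard (∂ (Bx a b c d)) n × (+ n ≡ (b - a) + (d - c) + + 4)
lemma5p7 a b c d rep@((_ , (a≤u , u≤b) , (c≤v , v≤d)) , _)
  with nonneg-gap (ℤP.≤-trans a≤u u≤b) | nonneg-gap (ℤP.≤-trans c≤v v≤d)
... | W , refl | H , refl =
  W ℕ.+ H ℕ.+ 4 ,
  HasCard-resp (Bx⁺∖Bx≐∂ a≤b c≤d (IsBoxRep⇒Tight rep)) (HasCard-resp (Frame≐Bx⁺∖Bx a≤b c≤d) (Frame-card a c W H)) ,
  trans (ℤP.pos-+ (W ℕ.+ H) 4) (trans (cong (_+ + 4) (ℤP.pos-+ W H)) (ring a c (+ W) (+ H)))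
  where
  a≤b = ℤP.≤-trans a≤u u≤b
  c≤d = ℤP.≤-trans c≤v v≤d
  ring : ∀ a c w h → w + h + + 4 ≡ ((a + w) - a) + ((c + h) - c) + + 4
  ring = solve-∀
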